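{- Let $\mathcal{S}=(X,A,\to,\leq,x_0)$ be the OLTS associated with a counter machine (with arbitrary zero tests), ordered by the extended ordering. If the labelled reduced reachability tree $\mathrm{lRRT}(\mathcal{S},x_0)$ has at least one iterable node, then $\mathcal{S}$ is non-terminating, i.e. there is an infinite run from $x_0$.
   Context: A counter machine is $\mathcal{C}=(Q,\mathsf{C},T,q_0)$ with finite control states $Q$, finite counter set $\mathsf{C}$, $T\subseteq Q\times A\times Q$ where $A=\{\mathsf{inc}(c),\mathsf{dec}(c),\mathsf{noop}\mid c\in\mathsf{C}\}\times 2^{\mathsf{C}}$. States $X=Q\times\mathbb{N}^{\mathsf{C}}$, $x_0=(q_0,\mathbf{0})$; $(q,\mathbf{v})\xrightarrow{(op,Z)}(q',\mathbf{v}')$ iff $(q,(op,Z),q')\in T$, $\mathbf{v}_b=0$ for all $b\in Z$, and $\mathbf{v}'$ is $\mathbf{v}$ with counter $c$ incremented (if $op=\mathsf{inc}(c)$), decremented staying in $\mathbb{N}$ (if $op=\mathsf{dec}(c)$), or unchanged (if $op=\mathsf{noop}$). Extended ordering: $(q,\mathbf{v})\leq(q',\mathbf{v}')$ iff $q=q'$ and $\mathbf{v}\leq\mathbf{v}'$ componentwise. $\mathrm{Post}(x)=\{y\mid x\to y\}$. The reduced reachability tree $\mathrm{RRT}(\mathcal{S},x_0)$: root labelled $x_0$ with a child labelled $x$ for each $x\in\mathrm{Post}(x_0)$; repeatedly an unmarked vertex $n$ labelled $x$ is picked: if it has an ancestor $n'$ labelled $x'$ with $x'\leq x$, $n$ is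 marked dead and $n'$ subsumes $n$; otherwise $n$ is marked live and gets a child labelled $y$ for each $y\in\mathrm{Post}(x)$. The labelled RRT $\mathrm{lRRT}(\mathcal{S},x_0)$ additionally marks a dead vertex $n'$ labelled $x'$ as iterable if it is subsumed by a node $n$ labelled $x$ (so $x\leq x'$) with $x\xrightarrow{\sigma}x'$ for some action word $\sigma$, and there exists $x''\in X$ with $x'\xrightarrow{\sigma}x''$ and $x'\leq x''$. -}

module Defs where

open import Data.Nat using (ℕ; zero; suc; _≤_; _<_)
open import Data.Fin using (Fin)
open import Data.Fin.Subset using (Subset; _∈_)
open import Data.Vec using (Vec; replicate; lookup; updateAt; _[_]≔_)
open import Data.Vec.Relation.Binary.Pointwise.Inductive using (Pointwise)
open import Data.List using (List; []; _∷_)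
import Data.List.Membership.Propositional as ListMem
open import Data.Product using (Σ; ∃; _×_; _,_)
open import Relation.Binary.PropositionalEquality using (_≡_)
open import Relation.Nullary using (¬_)

data Op (k : ℕ) : Set where
  inc  : Fin k → Op k
  dec  : Fin k → Op k
  noop : Op k

-- Actions A = {inc(c),dec(c),noop} × 2^C   (second component: zero-tested counters)
Action : ℕ → Set
Action k = Op k × Subset k

record CounterMachine : Set where
  field
    m  : ℕ
    k  : ℕ
    T  : List (Fin m × Action k × Fin m)
    q0 : Fin m

module _ (𝒞 : CounterMachine) where
  open CounterMachine 𝒞
  open ListMem using () renaming (_∈_ to _∈ₗ_)

  State : Set
  State = Fin m × Vec ℕ k

  x₀ : State
  x₀ = q0 , replicate k 0

  data Update : Op k → Vec ℕ k → Vec ℕ k → Set where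
    upd-inc  : ∀ c v → Update (inc c) v (updateAt v c suc)
    upd-dec  : ∀ c v n → lookup v c ≡ suc n → Update (dec c) v (v [ c ]≔ n)
    upd-noop : ∀ v → Update noop v v

  data Step : State → Action k → State → Set where
    step : ∀ {q q' v v'} (op : Op k) (Z : Subset k) →
           (q , (op , Z) , q') ∈ₗ T →
           (∀ b → b ∈ Z → lookup v b ≡ 0) →
           Update op v v' →
           Step (q , v) (op , Z) (q' , v')

  data Steps : State → List (Action k) → State → Set where
    done : ∀ {x} → Steps x [] x
    more : ∀ {x a y σ z} → Step x a y → Steps y σ z → Steps x (a ∷ σ) z

  _⟶_ : State → State → Set
  x ⟶ y = ∃ λ a → Step x a y

  _⊑_ : State → State → Set
  (q , v) ⊑ (q' , v') = q ≡ q' × Pointwise _≤_ v v'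

  -- A vertex of RRT(S,x₀) at depth d is identified with its branch from the root:
  -- the labels lab 0, …, lab d along the path (values beyond d are irrelevant).
  -- Such a branch is a vertex iff it starts at x₀, consecutive labels are
  -- successors, and every proper ancestor (index j < d) was marked live,
  -- i.e. has no ancestor i < j with lab i ⊑ lab j.
  record RRTVertex : Set where
    field
      depth : ℕ
      lab   : ℕ → State
      root  : lab 0 ≡ x₀
      edges : ∀ i → i < depth → lab i ⟶ lab (suc i)
      live  : ∀ j → j < depth → ∀ i → i < j → ¬ (lab i ⊑ lab j)

  Iterable : RRTVertex → Set
  Iterable n =
    Σ ℕ λ i → i < depth × lab i ⊑ lab depth ×
      (Σ (List (Action k)) λ σ → Steps (lab i) σ (lab depth) ×
         (Σ State λ x'' → Steps (lab depth) σ x'' × lab depth ⊑ x''))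
    where open RRTVertex n

  NonTerminating : Set
  NonTerminating = Σ (ℕ → State) λ r → r 0 ≡ x₀ × (∀ n → r n ⟶ r (suc n))

{-# OPTIONS --safe #-}
-- Let the iterable vertex x' = lab d be subsumed by its ancestor x = lab i, write
-- x' = x + Δ, and let σ run from x to x' and from x'. Every counter that σ zero-tests
-- on its run from x + Δ is zero in Δ, and updates commute with translation, so σ also
-- runs from x + nΔ to x + (n+1)Δ for every n: following the branch to x and then
-- iterating σ gives an infinite run.
-- If σ is empty then x = x', and the branch from x to x' is already a cycle.
module Submission where

open import Defs
open import Data.Product using (Σ; ∃; _×_; _,_; proj₁; proj₂)
open import Data.Nat
  using (ℕ; zero; suc; _+_; _*_; _∸_; _≤_; _<_; _≤′_; ≤′-refl; ≤′-step; z≤n; s≤s)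
open import Data.Nat.Properties
  using (+-assoc; +-identityʳ; *-zeroʳ; m+n≡0⇒n≡0; m+[n∸m]≡n; suc-injective; <⇒≤; ≤⇒≤′; ≤-refl)
open import Data.Fin using (Fin)
open import Data.Fin.Subset using (_∈_)
open import Data.Vec using (Vec; []; _∷_; lookup; updateAt; _[_]≔_; zipWith; map)
open import Data.Vec.Properties using (lookup-zipWith; lookup-map)
open import Data.Vec.Relation.Binary.Pointwise.Inductive using (Pointwise; []; _∷_)
open import Data.List using ([]; _∷_)
open import Relation.Binary.Construct.Closure.ReflexiveTransitive using (Star; ε; _◅_; _◅◅_)
open import Relation.Binary.Construct.Closure.Transitive using (TransClosure; [_]; _∷_)
open import Relation.Binary.PropositionalEquality using (_≡_; refl; sym; trans; cong; cong₂; subst)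

private
  variable
    l : ℕ

infixl 6 _⊕_
infixr 7 _·_
infix 4 _⊆ˢ_

_⊕_ : Vec ℕ l → Vec ℕ l → Vec ℕ l
_⊕_ = zipWith _+_

_·_ : ℕ → Vec ℕ l → Vec ℕ l
n · D = map (n *_) D

_⊆ˢ_ : Vec ℕ l → Vec ℕ l → Set
E ⊆ˢ D = ∀ b → lookup D b ≡ 0 → lookup E b ≡ 0

lookup-⊕ : ∀ (u D : Vec ℕ l) b → lookup (u ⊕ D) b ≡ lookup u b + lookup D b
lookup-⊕ u D b = lookup-zipWith _+_ b u D

·-⊆ˢ : ∀ n (D : Vec ℕ l) → n · D ⊆ˢ D
·-⊆ˢ n D b Db≡0 = trans (lookup-map b (n *_) D) (trans (cong (n *_) Db≡0) (*-zeroʳ n))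

⊕-0· : ∀ (u D : Vec ℕ l) → u ⊕ 0 · D ≡ u
⊕-0· []      []      = refl
⊕-0· (x ∷ u) (d ∷ D) = cong₂ _∷_ (+-identityʳ x) (⊕-0· u D)

⊕-suc· : ∀ (u D : Vec ℕ l) n → u ⊕ D ⊕ n · D ≡ u ⊕ suc n · D
⊕-suc· []      []      n = refl
⊕-suc· (x ∷ u) (d ∷ D) n = cong₂ _∷_ (+-assoc x d (n * d)) (⊕-suc· u D n)

≤⇒⊕-difference : ∀ {u u' : Vec ℕ l} → Pointwise _≤_ u u' → ∃ λ Δ → u ⊕ Δ ≡ u'
≤⇒⊕-difference []                                 = [] , refl
≤⇒⊕-difference {u = x ∷ _} {y ∷ _} (x≤y ∷ u≤u') with ≤⇒⊕-difference u≤u'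
... | Δ , u⊕Δ≡u' = y ∸ x ∷ Δ , cong₂ _∷_ (m+[n∸m]≡n x≤y) u⊕Δ≡u'

updateAt-suc-⊕ : ∀ (u D : Vec ℕ l) c → updateAt (u ⊕ D) c suc ≡ updateAt u c suc ⊕ D
updateAt-suc-⊕ (x ∷ u) (d ∷ D) Fin.zero    = refl
updateAt-suc-⊕ (x ∷ u) (d ∷ D) (Fin.suc c) = cong (x + d ∷_) (updateAt-suc-⊕ u D c)

[]≔-⊕ : ∀ (u D : Vec ℕ l) c n → (u ⊕ D) [ c ]≔ (n + lookup D c) ≡ (u [ c ]≔ n) ⊕ D
[]≔-⊕ (x ∷ u) (d ∷ D) Fin.zero    n = refl
[]≔-⊕ (x ∷ u) (d ∷ D) (Fin.suc c) n = cong (x + d ∷_) ([]≔-⊕ u D c n)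

module _ {A : Set} {R : A → A → Set} where

  InfinitePath : A → Set
  InfinitePath a = Σ (ℕ → A) λ r → r 0 ≡ a × ∀ n → R (r n) (r (suc n))

  _◅◅⁺_ : ∀ {x y z} → Star R x y → TransClosure R y z → TransClosure R x z
  ε       ◅◅⁺ p = p
  (e ◅ s) ◅◅⁺ p = e ∷ (s ◅◅⁺ p)

  invariant⇒infinitePath : ∀ {a} (P : A → Set) → P a → (∀ {x} → P x → ∃ λ y → R x y × P y) → InfinitePath a
  invariant⇒infinitePath {a} P Pa next = (λ n → proj₁ (run n)) , refl , λ n → proj₁ (proj₂ (next′ n))
    where
    run : ℕ → Σ A P
    next′ : ∀ n → ∃ λ y → R (proj₁ (run n)) y × P y
    run zero    = a , Pa
    run (suc n) = proj₁ (next′ n) , proj₂ (proj₂ (next′ n))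
    next′ n = next (proj₂ (run n))

  chain⇒infinitePath : ∀ {a} (g : ℕ → A) → Star R a (g 0) → (∀ n → TransClosure R (g n) (g (suc n))) →
                       InfinitePath a
  chain⇒infinitePath g a→g₀ g-step = invariant⇒infinitePath OnTheWay (1 , a→g₀ ◅◅⁺ g-step 0) next
    where
    OnTheWay : A → Set
    OnTheWay x = ∃ λ n → TransClosure R x (g n)
    next : ∀ {x} → OnTheWay x → ∃ λ y → R x y × OnTheWay y
    next (n , [ e ])   = g n , e , suc n , g-step n
    next (n , (e ∷ p)) = _ , e , n , p

  cycle⇒infinitePath : ∀ {a x} → Star R a x → TransClosure R x x → InfinitePath a
  cycle⇒infinitePath {x = x} a→x x→x = chain⇒infinitePath (λ _ → x) a→x (λ _ → x→x)

module _ (𝒞 : CounterMachine) where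
  open CounterMachine 𝒞 using (k)

  Update-⊕ : ∀ {op u u'} (D : Vec ℕ k) → Update 𝒞 op u u' → Update 𝒞 op (u ⊕ D) (u' ⊕ D)
  Update-⊕ D (upd-inc c u) =
    subst (Update 𝒞 (inc c) (u ⊕ D)) (updateAt-suc-⊕ u D c) (upd-inc c (u ⊕ D))
  Update-⊕ D (upd-dec c u n uc≡1+n) =
    subst (Update 𝒞 (dec c) (u ⊕ D)) ([]≔-⊕ u D c n)
      (upd-dec c (u ⊕ D) (n + lookup D c) (trans (lookup-⊕ u D c) (cong (_+ lookup D c) uc≡1+n)))
  Update-⊕ D (upd-noop u) = upd-noop (u ⊕ D)

  Update-deterministic : ∀ {op u u' u''} → Update 𝒞 op u u' → Update 𝒞 op u u'' → u' ≡ u''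
  Update-deterministic (upd-inc c u)       (upd-inc .c .u)        = refl
  Update-deterministic (upd-dec c u n eq₁) (upd-dec .c .u n′ eq₂) =
    cong (u [ c ]≔_) (suc-injective (trans (sym eq₁) eq₂))
  Update-deterministic (upd-noop u)        (upd-noop .u)          = refl

  -- A zero test passing at u ⊕ D only tests counters outside supp D, hence outside supp E.
  Steps-shift : ∀ {q q' p u u' σ y} {D E : Vec ℕ k} → E ⊆ˢ D →
                Steps 𝒞 (q , u) σ (q' , u') → Steps 𝒞 (p , u ⊕ D) σ y →
                Steps 𝒞 (q , u ⊕ E) σ (q' , u' ⊕ E)
  Steps-shift E⊆D done _ = done
  Steps-shift {u = u} {D = D} {E} E⊆D
    (more (step op Z t∈T zero-tests upd) run) (more (step .op .Z _ zero-tests′ upd′) run′) =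
    more (step op Z t∈T zero-tests-⊕E (Update-⊕ E upd))
         (Steps-shift E⊆D run (subst (λ w → Steps 𝒞 (_ , w) _ _) (sym u'⊕D≡w) run′))
    where
    u'⊕D≡w = Update-deterministic (Update-⊕ D upd) upd′
    zero-tests-⊕E : ∀ b → b ∈ Z → lookup (u ⊕ E) b ≡ 0
    zero-tests-⊕E b b∈Z = trans (lookup-⊕ u E b) (cong₂ _+_ (zero-tests b b∈Z)
      (E⊆D b (m+n≡0⇒n≡0 (lookup u b) (trans (sym (lookup-⊕ u D b)) (zero-tests′ b b∈Z)))))

  Steps-pump : ∀ {q u σ y} {Δ : Vec ℕ k} →
               Steps 𝒞 (q , u) σ (q , u ⊕ Δ) → Steps 𝒞 (q , u ⊕ Δ) σ y →
               ∀ n → Steps 𝒞 (q , u ⊕ n · Δ) σ (q , u ⊕ suc n · Δ)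
  Steps-pump {q} {u} {σ} {Δ = Δ} run run′ n =
    subst (λ w → Steps 𝒞 (q , u ⊕ n · Δ) σ (q , w)) (⊕-suc· u Δ n) (Steps-shift (·-⊆ˢ n Δ) run run′)

  Steps-[]⇒≡ : ∀ {x y} → Steps 𝒞 x [] y → x ≡ y
  Steps-[]⇒≡ done = refl

  Steps⁺⇒TransClosure : ∀ {x a τ y} → Steps 𝒞 x (a ∷ τ) y → TransClosure (_⟶_ 𝒞) x y
  Steps⁺⇒TransClosure (more s done)       = [ _ , s ]
  Steps⁺⇒TransClosure (more s (more t r)) = (_ , s) ∷ Steps⁺⇒TransClosure (more t r)

  pumpable⇒nonTerminating : ∀ {x x' x'' a τ} → Star (_⟶_ 𝒞) (x₀ 𝒞) x → _⊑_ 𝒞 x x' →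
                            Steps 𝒞 x (a ∷ τ) x' → Steps 𝒞 x' (a ∷ τ) x'' → NonTerminating 𝒞
  pumpable⇒nonTerminating {q , u} {.q , u'} reach (refl , u≤u') run run′ with ≤⇒⊕-difference u≤u'
  ... | Δ , refl = chain⇒infinitePath (λ n → q , u ⊕ n · Δ)
                     (subst (λ w → Star (_⟶_ 𝒞) (x₀ 𝒞) (q , w)) (sym (⊕-0· u Δ)) reach)
                     (λ n → Steps⁺⇒TransClosure (Steps-pump run run′ n))

  module _ (v : RRTVertex 𝒞) where
    open RRTVertex v

    branch : ∀ {i j} → i ≤′ j → j ≤ depth → Star (_⟶_ 𝒞) (lab i) (lab j)
    branch ≤′-refl           _      = ε
    branch (≤′-step i≤′j) 1+j≤d = branch i≤′j (<⇒≤ 1+j≤d) ◅◅ (edges _ 1+j≤d ◅ ε)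

    reach : ∀ {i} → i ≤ depth → Star (_⟶_ 𝒞) (x₀ 𝒞) (lab i)
    reach i≤d = subst (λ x → Star (_⟶_ 𝒞) x _) root (branch (≤⇒≤′ z≤n) i≤d)

    branch⁺ : ∀ {i j} → i < j → j ≤ depth → TransClosure (_⟶_ 𝒞) (lab i) (lab j)
    branch⁺ {j = suc j} (s≤s i≤j) 1+j≤d = branch (≤⇒≤′ i≤j) (<⇒≤ 1+j≤d) ◅◅⁺ [ edges j 1+j≤d ]

proposition4p10 : (𝒞 : CounterMachine) →
    Σ (RRTVertex 𝒞) (Iterable 𝒞) → NonTerminating 𝒞
proposition4p10 𝒞 (v , i , i<d , x⊑x' , [] , x→x' , _) =
  cycle⇒infinitePath (reach 𝒞 v (<⇒≤ i<d))
    (subst (TransClosure (_⟶_ 𝒞) _) (sym (Steps-[]⇒≡ 𝒞 x→x')) (branch⁺ 𝒞 v i<d ≤-refl))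
proposition4p10 𝒞 (v , i , i<d , x⊑x' , _ ∷ _ , x→x' , _ , x'→x'' , _) =
  pumpable⇒nonTerminating 𝒞 (reach 𝒞 v (<⇒≤ i<d)) x⊑x' x→x' x'→x''
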